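{- Let $\mathbb{K}\in\{\mathbb{Z},\mathbb{Q}\}$, $d,\alpha\in\mathbb{N}$, $L$ an arbitrary set, and $f_1,f_2,g\colon L\times\mathbb{Q}^d\to\mathbb{Q}$. If $f_1$, $f_2$, and $g$ are $\alpha$-$\mathbb{K}$-linearizable, then the function $h\colon L\times\mathbb{Q}^d\to\mathbb{Q}$ with $h(x,w)=f_1(x,w)$ if $g(x,w)\le 0$ and $h(x,w)=f_2(x,w)$ otherwise is $\alpha$-$\mathbb{K}$-linearizable.
   Context: For $r\in\mathbb{N}$ let $\mathbb{Z}_r=\{\pm p : p\in\{0,\dots,r\}\}$ and $\mathbb{Q}_r=\{\pm p/q : p\in\{0,\dots,r\},\ q\in\{1,\dots,r\}\}$. For $\mathbb{K}\in\{\mathbb{Z},\mathbb{Q}\}$ and $r,d\in\mathbb{N}$, two vectors $w,w'\in\mathbb{Q}^d$ are called $(r,\mathbb{K}^d)$-equivalent if for every $\beta\in\mathbb{K}_r^d$ with $\|\beta\|_1\le r$ one has $\mathrm{sign}(\beta^\top w)=\mathrm{sign}(\beta^\top w')$; write $[w]_r^{\mathbb{K}^d}$ for the set of all $w'\in\mathbb{Q}^d$ that are $(r,\mathbb{K}^d)$-equivalent to $w$. A function $f\colon L\times\mathbb{Q}^d\to\mathbb{Q}$ is $\alpha$-$\mathbb{K}$-linearizable ($\alpha\in\mathbb{N}$) if for all $w\in\mathbb{Q}^d$ and all $x\in L$ there exists $b_{x,w}\in\mathbb{K}_\alpha^d$ with $\|b_{x,w}\|_1\le\alpha$ such that $f(x,w')=b_{x,w}^\top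 w'$ for all $w'\in[w]_\alpha^{\mathbb{K}^d}$. -}

module Defs where

open import Data.Nat as ℕ using (ℕ; suc)
open import Data.Integer as ℤ using (ℤ; +_)
open import Data.Rational as ℚ using (ℚ; 0ℚ; _≤_; _≤ᵇ_; _+_; _*_; -_; ∣_∣; _/_)
open import Data.Fin using (Fin; zero; suc)
open import Data.Bool using (if_then_else_)
open import Data.Product using (Σ; _×_)
open import Data.Sum using (_⊎_)
open import Relation.Binary.PropositionalEquality using (_≡_)

data 𝕂 : Set where
  Kℤ Kℚ : 𝕂

-- Membership in ℤ_r = {±p : p ∈ {0..r}} and ℚ_r = {±p/q : p ∈ {0..r}, q ∈ {1..r}},
-- both viewed as subsets of ℚ.  In the ℚ case the denominator is q = suc q' with suc q' ≤ r.
InKr : 𝕂 → ℕ → ℚ → Set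
InKr Kℤ r x = Σ ℕ λ p → p ℕ.≤ r × (x ≡ (+ p) / 1 ⊎ x ≡ - ((+ p) / 1))
InKr Kℚ r x = Σ ℕ λ p → Σ ℕ λ q' → p ℕ.≤ r × suc q' ℕ.≤ r ×
  (x ≡ (+ p) / suc q' ⊎ x ≡ - ((+ p) / suc q'))

Vecℚ : ℕ → Set
Vecℚ d = Fin d → ℚ

sumℚ : ∀ {d} → (Fin d → ℚ) → ℚ
sumℚ {ℕ.zero} v = 0ℚ
sumℚ {suc d} v = v zero + sumℚ (λ i → v (suc i))

dot : ∀ {d} → Vecℚ d → Vecℚ d → ℚ
dot β w = sumℚ (λ i → β i * w i)

norm1 : ∀ {d} → Vecℚ d → ℚ
norm1 β = sumℚ (λ i → ∣ β i ∣)

Admissible : 𝕂 → (r d : ℕ) → Vecℚ d → Set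
Admissible K r d β = ((i : Fin d) → InKr K r (β i)) × norm1 β ≤ (+ r) / 1

data Sign : Set where
  neg zer pos : Sign

sign : ℚ → Sign
sign q = if q ≤ᵇ 0ℚ then (if 0ℚ ≤ᵇ q then zer else neg) else pos

Equiv : 𝕂 → (r d : ℕ) → Vecℚ d → Vecℚ d → Set
Equiv K r d w w' = (β : Vecℚ d) → Admissible K r d β → sign (dot β w) ≡ sign (dot β w')

Linearizable : 𝕂 → (α d : ℕ) → (L : Set) → (L → Vecℚ d → ℚ) → Set
Linearizable K α d L f =
  (w : Vecℚ d) (x : L) → Σ (Vecℚ d) λ b → Admissible K α d b ×
    ((w' : Vecℚ d) → Equiv K α d w w' → f x w' ≡ dot b w')

caseFun : ∀ {d} {L : Set} → (f₁ f₂ g : L → Vecℚ d → ℚ) → L → Vecℚ d → ℚ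
caseFun f₁ f₂ g x w = if g x w ≤ᵇ 0ℚ then f₁ x w else f₂ x w

-- The sign of g(x, ·) is constant on the class [w] (equal to that of the linear form that
-- represents g there, which is admissible and so cannot change sign within the class), so on
-- [w] the case split h(x, ·) always takes the same branch and coincides with f₁(x, ·) or f₂(x, ·).
module Submission where

open import Defs
open import Data.Nat using (ℕ)
open import Data.Rational using (ℚ; 0ℚ; _≤ᵇ_)
open import Data.Bool using (Bool; true; false; if_then_else_)
open import Data.Product using (Σ; _,_; _×_)
open import Relation.Binary.PropositionalEquality

nonPositive : Sign → Bool
nonPositive neg = true
nonPositive zer = true
nonPositive pos = false

nonPositive-sign : (q : ℚ) → nonPositive (sign q) ≡ (q ≤ᵇ 0ℚ)
nonPositive-sign q with q ≤ᵇ 0ℚ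
... | false = refl
... | true with 0ℚ ≤ᵇ q
...   | true  = refl
...   | false = refl

Equiv-refl : ∀ K r d (w : Vecℚ d) → Equiv K r d w w
Equiv-refl K r d w β _ = refl

LinearizableAt : 𝕂 → (α d : ℕ) → (Vecℚ d → ℚ) → Vecℚ d → Set
LinearizableAt K α d f w = Σ (Vecℚ d) λ b → Admissible K α d b ×
  ((w' : Vecℚ d) → Equiv K α d w w' → f w' ≡ dot b w')

module _ {K : 𝕂} {α d : ℕ} {w : Vecℚ d} where

  LinearizableAt⇒sign-invariant : ∀ {f} → LinearizableAt K α d f w →
    ∀ w' → Equiv K α d w w' → sign (f w') ≡ sign (f w)
  LinearizableAt⇒sign-invariant {f} (b , b-adm , f≡b) w' w~w' = begin
    sign (f w')      ≡⟨ cong sign (f≡b w' w~w') ⟩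
    sign (dot b w')  ≡⟨ sym (w~w' b b-adm) ⟩
    sign (dot b w)   ≡⟨ cong sign (sym (f≡b w (Equiv-refl K α d w))) ⟩
    sign (f w)       ∎
    where open ≡-Reasoning

  LinearizableAt⇒≤ᵇ0-invariant : ∀ {f} → LinearizableAt K α d f w →
    ∀ w' → Equiv K α d w w' → (f w' ≤ᵇ 0ℚ) ≡ (f w ≤ᵇ 0ℚ)
  LinearizableAt⇒≤ᵇ0-invariant {f} lin w' w~w' = begin
    f w' ≤ᵇ 0ℚ                 ≡⟨ sym (nonPositive-sign (f w')) ⟩
    nonPositive (sign (f w'))  ≡⟨ cong nonPositive (LinearizableAt⇒sign-invariant lin w' w~w') ⟩
    nonPositive (sign (f w))   ≡⟨ nonPositive-sign (f w) ⟩
    f w ≤ᵇ 0ℚ                  ∎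
    where open ≡-Reasoning

  LinearizableAt-resp : ∀ {f f'} → (∀ w' → Equiv K α d w w' → f' w' ≡ f w') →
    LinearizableAt K α d f w → LinearizableAt K α d f' w
  LinearizableAt-resp f'≡f (b , b-adm , f≡b) =
    b , b-adm , λ w' w~w' → trans (f'≡f w' w~w') (f≡b w' w~w')

  LinearizableAt-if : ∀ {c : Vecℚ d → Bool} {f₁ f₂} → (∀ w' → Equiv K α d w w' → c w' ≡ c w) →
    LinearizableAt K α d f₁ w → LinearizableAt K α d f₂ w →
    LinearizableAt K α d (λ w' → if c w' then f₁ w' else f₂ w') w
  LinearizableAt-if {c} {f₁} {f₂} c-invariant lin₁ lin₂ with c w
  ... | true  = LinearizableAt-resp (λ w' w~w' → cong (if_then f₁ w' else f₂ w') (c-invariant w' w~w')) lin₁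
  ... | false = LinearizableAt-resp (λ w' w~w' → cong (if_then f₁ w' else f₂ w') (c-invariant w' w~w')) lin₂

lemma29 : (K : 𝕂) (d α : ℕ) (L : Set) (f₁ f₂ g : L → Vecℚ d → ℚ) →
    Linearizable K α d L f₁ → Linearizable K α d L f₂ → Linearizable K α d L g →
    Linearizable K α d L (caseFun f₁ f₂ g)
lemma29 K d α L f₁ f₂ g lin₁ lin₂ lin-g w x =
  LinearizableAt-if (LinearizableAt⇒≤ᵇ0-invariant (lin-g w x)) (lin₁ w x) (lin₂ w x)
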